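{- Let $\mathbf{X}=\sum_{n\ge 0}\sum_{\pi}\mathbf{G}_\pi$, where for each $n$ the inner sum runs over all alternating signed permutations $\pi$ of size $n$ (the term for $n=0$ is $\mathbf{G}_\emptyset=1$). Then, with $d$ the linear map defined below, extended termwise to formal infinite sums, $$d\mathbf{X}=1+\mathbf{X}^2 .$$
   Context: A signed permutation of size $n$ is a word $\pi=\pi_1\cdots\pi_n$ over the integers such that $|\pi_1|,\dots,|\pi_n|$ is a permutation of $\{1,\dots,n\}$; equivalently a pair $(\sigma,\epsilon)$ with $\sigma\in\mathfrak S_n$, $\epsilon\in\{\pm1\}^n$ and $\pi_i=\epsilon_i\sigma(i)$. A negative letter $-k$ is also written $\bar k$. Letters are compared as integers. For a word $w$ of distinct integers, $\mathrm{std}(w)$ denotes the permutation of $\{1,\dots,|w|\}$ having the same relative order as the letters of $w$. ${\bf FQSym}^{(2)}$ is the algebra with basis $\mathbf{G}_{(\sigma,\epsilon)}$ indexed by signed permutations of all sizes $n\ge0$ (with unit $\mathbf G_\emptyset=1$) and product $\mathbf{G}_{(\alpha,\epsilon)}\mathbf{G}_{(\beta,\eta)}=\sum_{\gamma}\mathbf{G}_{(\gamma,\epsilon\cdot\eta)}$ for $(\alpha,\epsilon)$ of size $k$ and $(\beta,\eta)$ of size $l$, where $\gamma$ runs over the permutations in $\mathfrak S_{k+l}$ with $\mathrm{std}(\gamma_1\cdots\gamma_k)=\alpha$ and $\mathrm{std}(\gamma_{k+1}\cdots\gamma_{k+l})=\beta$, and $\epsilon\cdot\eta$ is the concatenation of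 sign vectors. Identities are taken in the completion consisting of formal infinite sums. A signed permutation $\pi$ of size $n$ is alternating if $\pi_1<\pi_2>\pi_3<\pi_4>\cdots$ (all signed permutations of size $0$ and $1$ are alternating). The linear map $d$ is defined by $d\,\mathbf{G}_\emptyset=0$ and, for $\pi$ of size $n\ge1$: if $\pi=u\,n\,v$ (the letter of absolute value $n$ is positive) then $d\mathbf{G}_\pi=\mathbf{G}_{uv}$, and if $\pi=u\,\bar n\,v$ then $d\mathbf{G}_\pi=\mathbf{G}_{u\bar v}$, where $\bar v$ is the word $v$ with the sign of every letter changed. -}

module Defs where

open import Data.Nat using (ℕ; zero; suc; _∸_; _*_; _+_) renaming (_<ᵇ_ to _<ℕᵇ_)
open import Data.Integer as ℤ using (ℤ; +_; -_; ∣_∣; sign)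
open import Data.Integer.Properties as ℤP using ()
open import Data.Sign as Sign using (Sign)
open import Data.Bool using (Bool; true; false; if_then_else_; _∧_)
open import Data.Nat.ListAction using (sum)
open import Data.List using (List; []; _∷_; [_]; map; concatMap; take; drop; length; upTo; _++_)
open import Data.List.Properties using (≡-dec)
open import Data.List.Relation.Binary.Permutation.Propositional using (_↭_)
open import Relation.Binary.PropositionalEquality using (_≡_)
open import Relation.Nullary.Decidable using (⌊_⌋)
open import Data.Product using (_×_)

IsSignedPerm : ℕ → List ℤ → Set
IsSignedPerm n π = map ∣_∣ π ↭ map suc (upTo n)

insertAll : ℕ → List ℕ → List (List ℕ)
insertAll x []       = [ x ∷ [] ]
insertAll x (y ∷ ys) = (x ∷ y ∷ ys) ∷ map (y ∷_) (insertAll x ys)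

perms : ℕ → List (List ℕ)
perms zero    = [ [] ]
perms (suc n) = concatMap (insertAll (suc n)) (perms n)

signings : List ℕ → List (List ℤ)
signings []       = [ [] ]
signings (x ∷ xs) = concatMap (λ s → ((+ x) ∷ s) ∷ ((- (+ x)) ∷ s) ∷ []) (signings xs)

signedPerms : ℕ → List (List ℤ)
signedPerms n = concatMap signings (perms n)

countLess : ℕ → List ℕ → ℕ
countLess x []       = 0
countLess x (y ∷ ys) = (if y <ℕᵇ x then 1 else 0) + countLess x ys

std : List ℕ → List ℕ
std w = map (λ x → suc (countLess x w)) w

mutual
  altUp : List ℤ → Bool
  altUp []            = true
  altUp (x ∷ [])      = true
  altUp (x ∷ y ∷ ys)  = ⌊ x ℤ.<? y ⌋ ∧ altDown (y ∷ ys)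

  altDown : List ℤ → Bool
  altDown []           = true
  altDown (x ∷ [])     = true
  altDown (x ∷ y ∷ ys) = ⌊ y ℤ.<? x ⌋ ∧ altUp (y ∷ ys)

Alternating : List ℤ → Bool
Alternating = altUp

dWord-aux : ℕ → List ℤ → List ℤ
dWord-aux n []       = []
dWord-aux n (x ∷ xs) with ⌊ x ℤ.≟ + n ⌋ | ⌊ x ℤ.≟ - (+ n) ⌋
... | true  | _     = xs
... | false | true  = map -_ xs
... | false | false = x ∷ dWord-aux n xs

dWord : List ℤ → List ℤ
dWord π = dWord-aux (length π) π

-- Elements of the completion of FQSym^(2): formal (infinite) sums
-- Σ_π F(π) G_π, represented by their coefficient function.

Series : Set
Series = List ℤ → ℕ

_==_ : List ℤ → List ℤ → Bool
u == v = ⌊ ≡-dec ℤ._≟_ u v ⌋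

_==ℕ_ : List ℕ → List ℕ → Bool
u ==ℕ v = ⌊ ≡-dec Data.Nat._≟_ u v ⌋
  where import Data.Nat

_==S_ : List Sign → List Sign → Bool
u ==S v = ⌊ ≡-dec Sign._≟_ u v ⌋

[_]ᵇ : Bool → ℕ
[ true ]ᵇ  = 1
[ false ]ᵇ = 0

one : Series
one []      = 1
one (_ ∷ _) = 0

_⊕_ : Series → Series → Series
(F ⊕ G) ρ = F ρ + G ρ

-- coefficient of G_ρ in the basis product G_α G_β (|α| = k):
-- ρ = (γ, ζ) occurs iff std(γ1..γk) = |α|, std(γk+1..) = |β|, ζ = ε·η
inProduct : List ℤ → List ℤ → List ℤ → ℕ
inProduct α β ρ =
  [ (std (take k γ) ==ℕ map ∣_∣ α)
    ∧ (std (drop k γ) ==ℕ map ∣_∣ β)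
    ∧ (map sign ρ ==S (map sign α ++ map sign β)) ]ᵇ
  where
    k = length α
    γ = map ∣_∣ ρ

_⊗_ : Series → Series → Series
(F ⊗ G) ρ =
  sum (map (λ k →
    sum (map (λ α →
      sum (map (λ β → F α * G β * inProduct α β ρ)
               (signedPerms (length ρ ∸ k))))
             (signedPerms k)))
    (upTo (suc (length ρ))))

-- d extended termwise: coefficient of G_ρ in dF is Σ_{π : dπ = ρ} F(π);
-- π ranges over signed permutations of size |ρ|+1 (d G_∅ = 0).
d : Series → Series
d F ρ = sum (map (λ π → if dWord π == ρ then F π else 0)
                 (signedPerms (suc (length ρ))))

X : Series
X π = [ Alternating π ]ᵇ

-- Compare coefficients at a signed permutation ρ of size n. The preimages of G_ρ under d are
-- the words obtained by inserting n+1 at one of the n+1 positions of ρ, or inserting −(n+1)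
-- and negating everything after it. Since n+1 exceeds and −(n+1) undercuts every letter, the
-- inserted letter is forced to be a peak or a valley by the parity of its position, so for
-- each position at most one of the two insertions alternates, and it does exactly when the
-- prefix and the suffix of ρ do; at the front only −(n+1) survives, unless ρ = ∅.
-- Hence [G_ρ] dX = [ρ = ∅] + Σ_k X(ρ₁⋯ρ_k) X(ρ_{k+1}⋯ρ_n). On the other side, G_ρ occurs in
-- G_α G_β exactly when α and β are the signed standardisations of a prefix of ρ and of the
-- complementary suffix, and standardisation preserves alternation, so [G_ρ] X² is the same sum.

module Submission where

open import Defs
open import Data.Bool using (Bool; true; false; if_then_else_; _∧_; not; T)
open import Data.Bool.Properties using (∧-conicalˡ; ∧-conicalʳ; ∧-assoc; ∧-zeroʳ)
open import Data.Empty using (⊥-elim)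
open import Data.Integer as ℤ using (ℤ; -[1+_]; -_; ∣_∣; sign; _◃_; -<-; -<+; +<+)
import Data.Integer.Properties as ℤ
open import Data.List using (List; []; _∷_; [_]; map; concatMap; applyUpTo; take; drop; length; upTo; _++_)
open import Data.List.Properties using (≡-dec; ∷-injectiveˡ; ∷-injectiveʳ; map-cong; map-++; map-∘; map-applyUpTo; length-map; length-take; length-drop; take-map; drop-map; take++drop≡id)
open import Data.List.Membership.Propositional using (_∈_; _∉_)
open import Data.List.Membership.Propositional.Properties using (∈-map⁺; ∈-++⁺ʳ)
open import Data.List.Relation.Unary.All as All using (All; []; _∷_)
import Data.List.Relation.Unary.All.Properties as All
open import Data.List.Relation.Unary.Any using (here; there)
open import Data.List.Relation.Unary.Unique.Propositional using (Unique; []; _∷_)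
import Data.List.Relation.Unary.Unique.Propositional.Properties as Unique
open import Data.List.Relation.Binary.Permutation.Propositional using (_↭_; module PermutationReasoning; ↭⇒↭ₛ; prep; swap; ↭-refl; ↭-reflexive; ↭-trans; ↭-sym)
import Data.List.Relation.Binary.Permutation.Setoid.Properties as Permutationₛ
open import Data.List.Relation.Binary.Permutation.Propositional.Properties using (∈-resp-↭; drop-∷; ++-comm; map⁺; ↭-empty-inv; ↭-length)
open import Data.Nat as ℕ using (ℕ; zero; suc; _+_; _*_; _∸_; _≤_; _<_; z≤n; s≤s) renaming (_<ᵇ_ to _<ℕᵇ_)
open import Data.Nat.ListAction using (sum)
open import Data.Nat.ListAction.Properties using (sum-++)
open import Data.Nat.Properties
open import Data.Nat.Tactic.RingSolver using (solve-∀)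
open import Data.Product using (_×_; _,_; proj₁; proj₂; map₂)
open import Data.Sign as Sign using (Sign)
open import Data.Unit using (tt)
open import Function using (id; _∘_)
open import Relation.Binary.Definitions using (DecidableEquality; tri<; tri≈; tri>)
open import Relation.Binary.PropositionalEquality hiding ([_])
open import Relation.Nullary using (¬_; Dec; yes; no)
open import Relation.Nullary.Decidable using (⌊_⌋; isYes≗does; dec-true; dec-false)

-- Sums and indicators

∑ : {A : Set} → List A → (A → ℕ) → ℕ
∑ L f = sum (map f L)

module _ {A : Set} where

  ∑-++ : (L M : List A) (f : A → ℕ) → ∑ (L ++ M) f ≡ ∑ L f + ∑ M f
  ∑-++ L M f = trans (cong sum (map-++ f L M)) (sum-++ (map f L) (map f M))

  ∑-cong : (L : List A) {f g : A → ℕ} → (∀ x → f x ≡ g x) → ∑ L f ≡ ∑ L g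
  ∑-cong L f≗g = cong sum (map-cong f≗g L)

  ∑-cong-All : {P : A → Set} (L : List A) {f g : A → ℕ} → All P L → (∀ x → P x → f x ≡ g x) → ∑ L f ≡ ∑ L g
  ∑-cong-All []      []       e = refl
  ∑-cong-All (x ∷ L) (p ∷ ps) e = cong₂ _+_ (e x p) (∑-cong-All L ps e)

  ∑-zero : (L : List A) → ∑ L (λ _ → 0) ≡ 0
  ∑-zero []      = refl
  ∑-zero (x ∷ L) = ∑-zero L

  ∑-+ : (L : List A) (f g : A → ℕ) → ∑ L (λ x → f x + g x) ≡ ∑ L f + ∑ L g
  ∑-+ []      f g = refl
  ∑-+ (x ∷ L) f g = trans (cong (f x + g x +_) (∑-+ L f g)) (+-exch (f x) (g x) (∑ L f) (∑ L g))
    where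
    +-exch : ∀ a b c e → a + b + (c + e) ≡ a + c + (b + e)
    +-exch = solve-∀

  ∑-*ˡ : (L : List A) (c : ℕ) (f : A → ℕ) → ∑ L (λ x → c * f x) ≡ c * ∑ L f
  ∑-*ˡ []      c f = sym (*-zeroʳ c)
  ∑-*ˡ (x ∷ L) c f = trans (cong (c * f x +_) (∑-*ˡ L c f)) (sym (*-distribˡ-+ c (f x) _))

  ∑-linear : (L : List A) (a b : ℕ) (f g : A → ℕ) → ∑ L (λ x → a * f x + b * g x) ≡ a * ∑ L f + b * ∑ L g
  ∑-linear L a b f g = trans (∑-+ L _ _) (cong₂ _+_ (∑-*ˡ L a f) (∑-*ˡ L b g))

  ∑-*ʳ : (L : List A) (c : ℕ) (f : A → ℕ) → ∑ L (λ x → f x * c) ≡ ∑ L f * c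
  ∑-*ʳ L c f = trans (∑-cong L (λ x → *-comm (f x) c)) (trans (∑-*ˡ L c f) (*-comm c _))

∑-map : {A B : Set} (g : A → B) (L : List A) (f : B → ℕ) → ∑ (map g L) f ≡ ∑ L (f ∘ g)
∑-map g L f = cong sum (sym (map-∘ L))

∑-concatMap : {A B : Set} (g : A → List B) (L : List A) (f : B → ℕ) → ∑ (concatMap g L) f ≡ ∑ L (λ x → ∑ (g x) f)
∑-concatMap g []      f = refl
∑-concatMap g (x ∷ L) f = trans (∑-++ (g x) (concatMap g L) f) (cong (∑ (g x) f +_) (∑-concatMap g L f))

module _ {A : Set} where

  ⌊_⌋-yes : (a? : Dec A) → A → ⌊ a? ⌋ ≡ true
  ⌊ a? ⌋-yes a = trans (isYes≗does a?) (dec-true a? a)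

  ⌊_⌋-no : (a? : Dec A) → ¬ A → ⌊ a? ⌋ ≡ false
  ⌊ a? ⌋-no ¬a = trans (isYes≗does a?) (dec-false a? ¬a)

  ⌊⌋-cong : {B : Set} (a? : Dec A) (b? : Dec B) → (A → B) → (B → A) → ⌊ a? ⌋ ≡ ⌊ b? ⌋
  ⌊⌋-cong a? (yes b) A→B B→A = ⌊ a? ⌋-yes (B→A b)
  ⌊⌋-cong a? (no ¬b) A→B B→A = ⌊ a? ⌋-no (¬b ∘ A→B)

  [_]ᵇ-yes : (a? : Dec A) → A → [ ⌊ a? ⌋ ]ᵇ ≡ 1
  [ a? ]ᵇ-yes a = cong [_]ᵇ (⌊ a? ⌋-yes a)

  [_]ᵇ-no : (a? : Dec A) → ¬ A → [ ⌊ a? ⌋ ]ᵇ ≡ 0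
  [ a? ]ᵇ-no ¬a = cong [_]ᵇ (⌊ a? ⌋-no ¬a)

  ⌊_⌋-sound : (a? : Dec A) → ⌊ a? ⌋ ≡ true → A
  ⌊ yes a ⌋-sound _ = a

module _ {A : Set} (_≟_ : DecidableEquality A) where

  [≡-dec]-∷ : ∀ a b u v → [ ⌊ ≡-dec _≟_ (a ∷ u) (b ∷ v) ⌋ ]ᵇ ≡ [ ⌊ a ≟ b ⌋ ]ᵇ * [ ⌊ ≡-dec _≟_ u v ⌋ ]ᵇ
  [≡-dec]-∷ a b u v with a ≟ b | ≡-dec _≟_ u v
  ... | yes refl | yes refl = refl
  ... | yes refl | no _     = refl
  ... | no _     | _        = refl

  [≡-dec]-∷-≡ : ∀ a u v → [ ⌊ ≡-dec _≟_ (a ∷ u) (a ∷ v) ⌋ ]ᵇ ≡ [ ⌊ ≡-dec _≟_ u v ⌋ ]ᵇ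
  [≡-dec]-∷-≡ a u v = trans ([≡-dec]-∷ a a u v) (trans (cong (_* _) ([ a ≟ a ]ᵇ-yes refl)) (+-identityʳ _))

  [≡-dec]-∷-≢ : ∀ {a b} u v → ¬ a ≡ b → [ ⌊ ≡-dec _≟_ (a ∷ u) (b ∷ v) ⌋ ]ᵇ ≡ 0
  [≡-dec]-∷-≢ {a} {b} u v a≢b = trans ([≡-dec]-∷ a b u v) (cong (_* _) ([ a ≟ b ]ᵇ-no a≢b))

[∧]ᵇ : ∀ a b → [ a ∧ b ]ᵇ ≡ [ a ]ᵇ * [ b ]ᵇ
[∧]ᵇ true  b = sym (+-identityʳ _)
[∧]ᵇ false b = refl

[]ᵇ≡1⇒≡true : ∀ {b} → [ b ]ᵇ ≡ 1 → b ≡ true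
[]ᵇ≡1⇒≡true {true} _ = refl

[]ᵇ≢1⇒≡0 : ∀ {b} → ¬ [ b ]ᵇ ≡ 1 → [ b ]ᵇ ≡ 0
[]ᵇ≢1⇒≡0 {true}  ≢1 = ⊥-elim (≢1 refl)
[]ᵇ≢1⇒≡0 {false} _  = refl

if-then-else-[]ᵇ : ∀ b (x : ℕ) → (if b then x else 0) ≡ [ b ]ᵇ * x
if-then-else-[]ᵇ true  x = sym (+-identityʳ x)
if-then-else-[]ᵇ false x = refl

-- Enumerating signed permutations

signed-choice : ∀ y x (F : ℤ → ℕ) → 0 < y →
  [ ⌊ ℤ.+ y ℤ.≟ x ⌋ ]ᵇ * F (ℤ.+ y) + [ ⌊ - ℤ.+ y ℤ.≟ x ⌋ ]ᵇ * F (- ℤ.+ y) ≡ [ ⌊ y ℕ.≟ ∣ x ∣ ⌋ ]ᵇ * F x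
signed-choice (suc y) x F _ with ℤ.+ suc y ℤ.≟ x | -[1+ y ] ℤ.≟ x | suc y ℕ.≟ ∣ x ∣
... | yes refl | no _     | yes _ = +-identityʳ _
... | no _     | yes refl | yes _ = refl
... | yes refl | yes ()   | _
... | yes refl | _        | no ne = ⊥-elim (ne refl)
... | no _     | yes refl | no ne = ⊥-elim (ne refl)
... | no _     | no _     | no _  = refl
... | no ≢+    | no ≢-    | yes e with x
...   | ℤ.+ _     = ⊥-elim (≢+ (cong ℤ.+_ e))
...   | -[1+ _ ] = ⊥-elim (≢- (cong -[1+_] (suc-injective e)))

signings-pick : ∀ σ → All (0 <_) σ → ∀ p (φ : List ℤ → ℕ) →
  ∑ (signings σ) (λ π → [ π == p ]ᵇ * φ π) ≡ [ σ ==ℕ map ∣_∣ p ]ᵇ * φ p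
signings-pick []      []          []      φ = +-identityʳ _
signings-pick []      []          (_ ∷ _) φ = refl
signings-pick (x ∷ σ) (_ ∷ _)     []      φ = trans (∑-concatMap _ (signings σ) _) (∑-zero (signings σ))
signings-pick (x ∷ σ) (x>0 ∷ σ>0) (q ∷ p) φ = begin
  ∑ (concatMap (λ s → (x⁺ ∷ s) ∷ (x⁻ ∷ s) ∷ []) (signings σ)) f
    ≡⟨ ∑-concatMap _ (signings σ) f ⟩
  ∑ (signings σ) (λ s → f (x⁺ ∷ s) + (f (x⁻ ∷ s) + 0))
    ≡⟨ ∑-cong (signings σ) split ⟩
  ∑ (signings σ) (λ s → δ⁺ * g x⁺ s + δ⁻ * g x⁻ s)
    ≡⟨ ∑-linear (signings σ) δ⁺ δ⁻ (g x⁺) (g x⁻) ⟩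
  δ⁺ * ∑ (signings σ) (g x⁺) + δ⁻ * ∑ (signings σ) (g x⁻)
    ≡⟨ cong₂ (λ a b → δ⁺ * a + δ⁻ * b)
         (signings-pick σ σ>0 p (λ s → φ (x⁺ ∷ s))) (signings-pick σ σ>0 p (λ s → φ (x⁻ ∷ s))) ⟩
  δ⁺ * (c * φ (x⁺ ∷ p)) + δ⁻ * (c * φ (x⁻ ∷ p))
    ≡⟨ factor δ⁺ δ⁻ c _ _ ⟩
  c * (δ⁺ * φ (x⁺ ∷ p) + δ⁻ * φ (x⁻ ∷ p))
    ≡⟨ cong (c *_) (signed-choice x q (λ z → φ (z ∷ p)) x>0) ⟩
  c * (δ * φ (q ∷ p))
    ≡⟨ trans (reassoc c δ (φ (q ∷ p))) (cong (_* φ (q ∷ p)) (sym ([≡-dec]-∷ ℕ._≟_ x ∣ q ∣ σ (map ∣_∣ p)))) ⟩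
  [ (x ∷ σ) ==ℕ map ∣_∣ (q ∷ p) ]ᵇ * φ (q ∷ p)
    ∎
  where
  open ≡-Reasoning
  x⁺ x⁻ : ℤ
  x⁺ = ℤ.+ x
  x⁻ = - ℤ.+ x
  δ δ⁺ δ⁻ c : ℕ
  δ  = [ ⌊ x ℕ.≟ ∣ q ∣ ⌋ ]ᵇ
  δ⁺ = [ ⌊ x⁺ ℤ.≟ q ⌋ ]ᵇ
  δ⁻ = [ ⌊ x⁻ ℤ.≟ q ⌋ ]ᵇ
  c = [ σ ==ℕ map ∣_∣ p ]ᵇ
  f : List ℤ → ℕ
  f π = [ π == (q ∷ p) ]ᵇ * φ π
  g : ℤ → List ℤ → ℕ
  g z s = [ s == p ]ᵇ * φ (z ∷ s)
  split : ∀ s → f (x⁺ ∷ s) + (f (x⁻ ∷ s) + 0) ≡ δ⁺ * g x⁺ s + δ⁻ * g x⁻ s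
  split s = cong₂ _+_ (trans (cong (_* φ (x⁺ ∷ s)) ([≡-dec]-∷ ℤ._≟_ x⁺ q s p)) (*-assoc δ⁺ _ _))
                      (trans (+-identityʳ _) (trans (cong (_* φ (x⁻ ∷ s)) ([≡-dec]-∷ ℤ._≟_ x⁻ q s p)) (*-assoc δ⁻ _ _)))
  factor : ∀ a b c u v → a * (c * u) + b * (c * v) ≡ c * (a * u + b * v)
  factor = solve-∀
  reassoc : ∀ c a u → c * (a * u) ≡ a * c * u
  reassoc = solve-∀

signings-length : ∀ τ → All (λ π → length π ≡ length τ) (signings τ)
signings-length []      = refl ∷ []
signings-length (x ∷ τ) = All.concat⁺ (All.map⁺ (All.map (λ ≡len → cong suc ≡len ∷ cong suc ≡len ∷ []) (signings-length τ)))

upFrom : ℕ → ℕ → List ℕ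
upFrom a zero    = []
upFrom a (suc L) = a ∷ upFrom (suc a) L

length-upFrom : ∀ a L → length (upFrom a L) ≡ L
length-upFrom a zero    = refl
length-upFrom a (suc L) = cong suc (length-upFrom (suc a) L)

upFrom-∷ʳ : ∀ a L → upFrom a (suc L) ≡ upFrom a L ++ [ a + L ]
upFrom-∷ʳ a zero    = cong [_] (sym (+-identityʳ a))
upFrom-∷ʳ a (suc L) = cong (a ∷_) (trans (upFrom-∷ʳ (suc a) L) (cong (λ t → upFrom (suc a) L ++ [ t ]) (sym (+-suc a L))))

∈-upFrom⁻ : ∀ {y} a L → y ∈ upFrom a L → a ≤ y × y < a + L
∈-upFrom⁻ a (suc L) (here refl) = ≤-refl , m<m+n a (s≤s z≤n)
∈-upFrom⁻ {y} a (suc L) (there y∈) with ∈-upFrom⁻ (suc a) L y∈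
... | a<y , y<a+1+L = <⇒≤ a<y , subst (y <_) (sym (+-suc a L)) y<a+1+L

upFrom-positive : ∀ {n σ} → σ ↭ upFrom 1 n → All (0 <_) σ
upFrom-positive {n} σ↭ = All.tabulate (λ y∈ → proj₁ (∈-upFrom⁻ 1 n (∈-resp-↭ σ↭ y∈)))

suc∉upFrom : ∀ {n σ} → σ ↭ upFrom 1 n → suc n ∉ σ
suc∉upFrom {n} σ↭ n+1∈ = <-irrefl refl (proj₂ (∈-upFrom⁻ 1 n (∈-resp-↭ σ↭ n+1∈)))

upFrom-unique : ∀ a L → Unique (upFrom a L)
upFrom-unique a zero    = []
upFrom-unique a (suc L) = All.tabulate (λ y∈ a≡y → <⇒≢ (proj₁ (∈-upFrom⁻ (suc a) L y∈)) a≡y) ∷ upFrom-unique (suc a) L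

map-suc-upTo : ∀ n → map suc (upTo n) ≡ upFrom 1 n
map-suc-upTo n = trans (map-applyUpTo id suc n) (applyUpTo-shift n suc 1 (λ _ → refl))
  where
  applyUpTo-shift : ∀ n (f : ℕ → ℕ) a → (∀ i → f i ≡ a + i) → applyUpTo f n ≡ upFrom a n
  applyUpTo-shift zero    f a f≗ = refl
  applyUpTo-shift (suc n) f a f≗ =
    cong₂ _∷_ (trans (f≗ 0) (+-identityʳ a)) (applyUpTo-shift n (f ∘ suc) (suc a) (λ i → trans (f≗ (suc i)) (+-suc a i)))

insertAll-↭ : ∀ x σ → All (_↭ x ∷ σ) (insertAll x σ)
insertAll-↭ x []      = ↭-refl ∷ []
insertAll-↭ x (z ∷ σ) = ↭-refl ∷ All.map⁺ (All.map (λ τ↭ → ↭-trans (prep z τ↭) (swap z x ↭-refl)) (insertAll-↭ x σ))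

perms-↭ : ∀ n → All (_↭ upFrom 1 n) (perms n)
perms-↭ zero    = ↭-refl ∷ []
perms-↭ (suc n) = All.concat⁺ (All.map⁺ (All.map extend (perms-↭ n)))
  where
  top-last : suc n ∷ upFrom 1 n ↭ upFrom 1 (suc n)
  top-last = ↭-trans (++-comm [ suc n ] (upFrom 1 n)) (↭-reflexive (sym (upFrom-∷ʳ 1 n)))
  extend : ∀ {σ} → σ ↭ upFrom 1 n → All (_↭ upFrom 1 (suc n)) (insertAll (suc n) σ)
  extend σ↭ = All.map (λ τ↭ → ↭-trans τ↭ (↭-trans (prep (suc n) σ↭) top-last)) (insertAll-↭ (suc n) _)

removeFirst : ℕ → List ℕ → List ℕ
removeFirst x []       = []
removeFirst x (y ∷ ys) with y ℕ.≟ x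
... | yes _ = ys
... | no _  = y ∷ removeFirst x ys

removeFirst-↭ : ∀ x w → x ∈ w → w ↭ x ∷ removeFirst x w
removeFirst-↭ x (y ∷ ys) x∈ with y ℕ.≟ x
removeFirst-↭ x (y ∷ ys) x∈          | yes refl = ↭-refl
removeFirst-↭ x (y ∷ ys) (here refl) | no y≢x   = ⊥-elim (y≢x refl)
removeFirst-↭ x (y ∷ ys) (there x∈)  | no _     = ↭-trans (prep y (removeFirst-↭ x ys x∈)) (swap y x ↭-refl)

insertAll-count : ∀ x σ → x ∉ σ → ∀ w → x ∈ w →
  ∑ (insertAll x σ) (λ τ → [ τ ==ℕ w ]ᵇ) ≡ [ σ ==ℕ removeFirst x w ]ᵇ
insertAll-count x σ x∉σ (y ∷ w) x∈ with y ℕ.≟ x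
insertAll-count x [] x∉σ (y ∷ w) x∈ | yes refl = trans (+-identityʳ _) ([≡-dec]-∷-≡ ℕ._≟_ x [] w)
insertAll-count x [] x∉σ (y ∷ w) x∈ | no y≢x  = trans (+-identityʳ _) ([≡-dec]-∷-≢ ℕ._≟_ [] w (y≢x ∘ sym))
insertAll-count x (z ∷ σ) x∉σ (y ∷ w) x∈ | yes refl = begin
  [ (x ∷ z ∷ σ) ==ℕ (x ∷ w) ]ᵇ + ∑ (map (z ∷_) (insertAll x σ)) (λ τ → [ τ ==ℕ (x ∷ w) ]ᵇ)
    ≡⟨ cong₂ _+_ ([≡-dec]-∷-≡ ℕ._≟_ x (z ∷ σ) w) (∑-map (z ∷_) (insertAll x σ) _) ⟩
  [ (z ∷ σ) ==ℕ w ]ᵇ + ∑ (insertAll x σ) (λ τ → [ (z ∷ τ) ==ℕ (x ∷ w) ]ᵇ)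
    ≡⟨ cong ([ (z ∷ σ) ==ℕ w ]ᵇ +_) (trans (∑-cong (insertAll x σ) z≢x) (∑-zero (insertAll x σ))) ⟩
  [ (z ∷ σ) ==ℕ w ]ᵇ + 0
    ≡⟨ +-identityʳ _ ⟩
  [ (z ∷ σ) ==ℕ w ]ᵇ
    ∎
  where
  open ≡-Reasoning
  z≢x : ∀ τ → [ (z ∷ τ) ==ℕ (x ∷ w) ]ᵇ ≡ 0
  z≢x τ = [≡-dec]-∷-≢ ℕ._≟_ τ w (λ z≡x → x∉σ (here (sym z≡x)))
insertAll-count x (z ∷ σ) x∉σ (y ∷ w) x∈ | no y≢x = begin
  [ (x ∷ z ∷ σ) ==ℕ (y ∷ w) ]ᵇ + ∑ (map (z ∷_) (insertAll x σ)) (λ τ → [ τ ==ℕ (y ∷ w) ]ᵇ)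
    ≡⟨ cong₂ _+_ x≢y (∑-map (z ∷_) (insertAll x σ) _) ⟩
  ∑ (insertAll x σ) (λ τ → [ (z ∷ τ) ==ℕ (y ∷ w) ]ᵇ)
    ≡⟨ ∑-cong (insertAll x σ) (λ τ → [≡-dec]-∷ ℕ._≟_ z y τ w) ⟩
  ∑ (insertAll x σ) (λ τ → [ ⌊ z ℕ.≟ y ⌋ ]ᵇ * [ τ ==ℕ w ]ᵇ)
    ≡⟨ ∑-*ˡ (insertAll x σ) [ ⌊ z ℕ.≟ y ⌋ ]ᵇ (λ τ → [ τ ==ℕ w ]ᵇ) ⟩
  [ ⌊ z ℕ.≟ y ⌋ ]ᵇ * ∑ (insertAll x σ) (λ τ → [ τ ==ℕ w ]ᵇ)
    ≡⟨ cong ([ ⌊ z ℕ.≟ y ⌋ ]ᵇ *_) (insertAll-count x σ (x∉σ ∘ there) w (x∈w x∈)) ⟩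
  [ ⌊ z ℕ.≟ y ⌋ ]ᵇ * [ σ ==ℕ removeFirst x w ]ᵇ
    ≡⟨ sym ([≡-dec]-∷ ℕ._≟_ z y σ (removeFirst x w)) ⟩
  [ (z ∷ σ) ==ℕ (y ∷ removeFirst x w) ]ᵇ
    ∎
  where
  open ≡-Reasoning
  x≢y : [ (x ∷ z ∷ σ) ==ℕ (y ∷ w) ]ᵇ ≡ 0
  x≢y = [≡-dec]-∷-≢ ℕ._≟_ (z ∷ σ) w (y≢x ∘ sym)
  x∈w : x ∈ y ∷ w → x ∈ w
  x∈w (here x≡y) = ⊥-elim (y≢x (sym x≡y))
  x∈w (there x∈) = x∈

perms-count : ∀ n w → w ↭ upFrom 1 n → ∑ (perms n) (λ σ → [ σ ==ℕ w ]ᵇ) ≡ 1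
perms-count zero    w w↭ with ↭-empty-inv w↭
... | refl = refl
perms-count (suc n) w w↭ = begin
  ∑ (concatMap (insertAll (suc n)) (perms n)) (λ τ → [ τ ==ℕ w ]ᵇ)
    ≡⟨ ∑-concatMap (insertAll (suc n)) (perms n) _ ⟩
  ∑ (perms n) (λ σ → ∑ (insertAll (suc n) σ) (λ τ → [ τ ==ℕ w ]ᵇ))
    ≡⟨ ∑-cong-All (perms n) (perms-↭ n) (λ σ σ↭ → insertAll-count (suc n) σ (suc∉upFrom σ↭) w top∈w) ⟩
  ∑ (perms n) (λ σ → [ σ ==ℕ removeFirst (suc n) w ]ᵇ)
    ≡⟨ perms-count n (removeFirst (suc n) w) rest↭ ⟩
  1 ∎
  where
  open ≡-Reasoning
  w↭′ : w ↭ upFrom 1 n ++ [ suc n ]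
  w↭′ = ↭-trans w↭ (↭-reflexive (upFrom-∷ʳ 1 n))
  top∈w : suc n ∈ w
  top∈w = ∈-resp-↭ (↭-sym w↭′) (∈-++⁺ʳ (upFrom 1 n) (here refl))
  rest↭ : removeFirst (suc n) w ↭ upFrom 1 n
  rest↭ = drop-∷ (↭-trans (↭-sym (removeFirst-↭ (suc n) w top∈w)) (↭-trans w↭′ (++-comm (upFrom 1 n) [ suc n ])))

signedPerms-pick : ∀ n p (φ : List ℤ → ℕ) → map ∣_∣ p ↭ upFrom 1 n →
  ∑ (signedPerms n) (λ π → [ π == p ]ᵇ * φ π) ≡ φ p
signedPerms-pick n p φ p↭ = begin
  ∑ (signedPerms n) (λ π → [ π == p ]ᵇ * φ π)
    ≡⟨ ∑-concatMap signings (perms n) _ ⟩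
  ∑ (perms n) (λ σ → ∑ (signings σ) (λ π → [ π == p ]ᵇ * φ π))
    ≡⟨ ∑-cong-All (perms n) (perms-↭ n) (λ σ σ↭ → signings-pick σ (upFrom-positive σ↭) p φ) ⟩
  ∑ (perms n) (λ σ → [ σ ==ℕ map ∣_∣ p ]ᵇ * φ p)
    ≡⟨ ∑-*ʳ (perms n) (φ p) _ ⟩
  ∑ (perms n) (λ σ → [ σ ==ℕ map ∣_∣ p ]ᵇ) * φ p
    ≡⟨ cong (_* φ p) (perms-count n (map ∣_∣ p) p↭) ⟩
  1 * φ p
    ≡⟨ *-identityˡ (φ p) ⟩
  φ p ∎
  where open ≡-Reasoning

signedPerms-length : ∀ n → All (λ π → length π ≡ n) (signedPerms n)
signedPerms-length n = All.concat⁺ (All.map⁺ (All.map (λ {σ} σ↭ →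
  All.map (λ ≡len → trans ≡len (trans (↭-length σ↭) (length-upFrom 1 n))) (signings-length σ)) (perms-↭ n)))

-- The coefficients of dF

map-neg-involutive : ∀ s → map -_ (map -_ s) ≡ s
map-neg-involutive []      = refl
map-neg-involutive (x ∷ s) = cong₂ _∷_ (ℤ.neg-involutive x) (map-neg-involutive s)

map-abs-neg : ∀ s → map ∣_∣ (map -_ s) ≡ map ∣_∣ s
map-abs-neg []      = refl
map-abs-neg (x ∷ s) = cong₂ _∷_ (ℤ.∣-i∣≡∣i∣ x) (map-abs-neg s)

[map-neg==]ᵇ : ∀ s ρ → [ map -_ s == ρ ]ᵇ ≡ [ s == map -_ ρ ]ᵇ
[map-neg==]ᵇ s ρ with ≡-dec ℤ._≟_ (map -_ s) ρ | ≡-dec ℤ._≟_ s (map -_ ρ)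
... | yes _   | yes _   = refl
... | yes -s≡ | no s≢   = ⊥-elim (s≢ (trans (sym (map-neg-involutive s)) (cong (map -_) -s≡)))
... | no -s≢  | yes s≡  = ⊥-elim (-s≢ (trans (cong (map -_) s≡) (map-neg-involutive ρ)))
... | no _    | no _    = refl

dWord-aux-+ : ∀ m xs → dWord-aux m (ℤ.+ m ∷ xs) ≡ xs
dWord-aux-+ m xs with ℤ.+ m ℤ.≟ ℤ.+ m
... | yes _ = refl
... | no ≢  = ⊥-elim (≢ refl)

dWord-aux-- : ∀ n xs → dWord-aux (suc n) (-[1+ n ] ∷ xs) ≡ map -_ xs
dWord-aux-- n xs with -[1+ n ] ℤ.≟ ℤ.+ suc n | -[1+ n ] ℤ.≟ -[1+ n ]
... | no _ | yes _ = refl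
... | no _ | no ≢  = ⊥-elim (≢ refl)

dWord-aux-∷ : ∀ m x xs → ¬ x ≡ ℤ.+ m → ¬ x ≡ - ℤ.+ m → dWord-aux m (x ∷ xs) ≡ x ∷ dWord-aux m xs
dWord-aux-∷ m x xs ≢+ ≢- with x ℤ.≟ ℤ.+ m | x ℤ.≟ - ℤ.+ m
... | yes ≡+ | _      = ⊥-elim (≢+ ≡+)
... | no _   | yes ≡- = ⊥-elim (≢- ≡-)
... | no _   | no _   = refl

-- For ρ of size n, these 2(n+1) words of size n+1 are exactly the π with dWord π ≡ ρ.
insert⁺ insert⁻ : ℕ → ℕ → List ℤ → List ℤ
insert⁺ n k ρ = take k ρ ++ ℤ.+ suc n ∷ drop k ρ
insert⁻ n k ρ = take k ρ ++ -[1+ n ] ∷ map -_ (drop k ρ)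

∑-preimages : ℕ → (List ℤ → ℕ) → List ℤ → ℕ
∑-preimages n φ ρ = ∑ (upTo (suc (length ρ))) (λ k → φ (insert⁺ n k ρ) + φ (insert⁻ n k ρ))

∑-upTo-suc : ∀ n f → ∑ (upTo (suc n)) f ≡ f 0 + ∑ (upTo n) (f ∘ suc)
∑-upTo-suc n f = cong (f 0 +_) (trans (cong (λ L → ∑ L f) (sym (map-applyUpTo id suc n))) (∑-map suc (upTo n) f))

∑-preimages-∷ : ∀ n φ x xs → ∑-preimages n φ (x ∷ xs)
  ≡ φ (ℤ.+ suc n ∷ x ∷ xs) + φ (-[1+ n ] ∷ map -_ (x ∷ xs)) + ∑-preimages n (φ ∘ (x ∷_)) xs
∑-preimages-∷ n φ x xs = ∑-upTo-suc (suc (length xs)) (λ k → φ (insert⁺ n k (x ∷ xs)) + φ (insert⁻ n k (x ∷ xs)))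

signings-d-front : ∀ n τ → All (0 <_) τ → ∀ ρ (φ : List ℤ → ℕ) →
  ∑ (signings (suc n ∷ τ)) (λ π → [ dWord-aux (suc n) π == ρ ]ᵇ * φ π)
    ≡ [ τ ==ℕ map ∣_∣ ρ ]ᵇ * (φ (ℤ.+ suc n ∷ ρ) + φ (-[1+ n ] ∷ map -_ ρ))
signings-d-front n τ τ>0 ρ φ = begin
  ∑ (signings (suc n ∷ τ)) f
    ≡⟨ ∑-concatMap _ (signings τ) f ⟩
  ∑ (signings τ) (λ s → f (ℤ.+ suc n ∷ s) + (f (-[1+ n ] ∷ s) + 0))
    ≡⟨ ∑-cong (signings τ) remove-top ⟩
  ∑ (signings τ) (λ s → [ s == ρ ]ᵇ * φ (ℤ.+ suc n ∷ s) + [ s == map -_ ρ ]ᵇ * φ (-[1+ n ] ∷ s))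
    ≡⟨ ∑-+ (signings τ) _ _ ⟩
  ∑ (signings τ) (λ s → [ s == ρ ]ᵇ * φ (ℤ.+ suc n ∷ s)) + ∑ (signings τ) (λ s → [ s == map -_ ρ ]ᵇ * φ (-[1+ n ] ∷ s))
    ≡⟨ cong₂ _+_ (signings-pick τ τ>0 ρ _) (signings-pick τ τ>0 (map -_ ρ) _) ⟩
  c * φ⁺ + [ τ ==ℕ map ∣_∣ (map -_ ρ) ]ᵇ * φ⁻
    ≡⟨ cong (λ w → c * φ⁺ + [ τ ==ℕ w ]ᵇ * φ⁻) (map-abs-neg ρ) ⟩
  c * φ⁺ + c * φ⁻
    ≡⟨ sym (*-distribˡ-+ c φ⁺ φ⁻) ⟩
  c * (φ⁺ + φ⁻) ∎
  where
  open ≡-Reasoning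
  c φ⁺ φ⁻ : ℕ
  c  = [ τ ==ℕ map ∣_∣ ρ ]ᵇ
  φ⁺ = φ (ℤ.+ suc n ∷ ρ)
  φ⁻ = φ (-[1+ n ] ∷ map -_ ρ)
  f : List ℤ → ℕ
  f π = [ dWord-aux (suc n) π == ρ ]ᵇ * φ π
  remove-top : ∀ s → f (ℤ.+ suc n ∷ s) + (f (-[1+ n ] ∷ s) + 0)
                   ≡ [ s == ρ ]ᵇ * φ (ℤ.+ suc n ∷ s) + [ s == map -_ ρ ]ᵇ * φ (-[1+ n ] ∷ s)
  remove-top s =
    cong₂ _+_ (cong (λ w → [ w == ρ ]ᵇ * φ (ℤ.+ suc n ∷ s)) (dWord-aux-+ (suc n) s))
              (trans (+-identityʳ _) (cong (_* φ (-[1+ n ] ∷ s))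
                (trans (cong (λ w → [ w == ρ ]ᵇ) (dWord-aux-- n s)) ([map-neg==]ᵇ s ρ))))

dWord-aux-skip : ∀ n y s → 0 < y → ¬ y ≡ suc n →
  dWord-aux (suc n) (ℤ.+ y ∷ s) ≡ ℤ.+ y ∷ dWord-aux (suc n) s × dWord-aux (suc n) (- ℤ.+ y ∷ s) ≡ - ℤ.+ y ∷ dWord-aux (suc n) s
dWord-aux-skip n (suc y) s _ y≢ =
  dWord-aux-∷ (suc n) (ℤ.+ suc y) s (y≢ ∘ ℤ.+-injective) (λ ()) ,
  dWord-aux-∷ (suc n) -[1+ y ] s (λ ()) (y≢ ∘ cong suc ∘ ℤ.-[1+-injective)

signings-d-skip-[] : ∀ n y τ → 0 < y → ¬ y ≡ suc n → (φ : List ℤ → ℕ) →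
  ∑ (signings (y ∷ τ)) (λ π → [ dWord-aux (suc n) π == [] ]ᵇ * φ π) ≡ 0
signings-d-skip-[] n y τ y>0 y≢ φ =
  trans (∑-concatMap _ (signings τ) _) (trans (∑-cong (signings τ) nonempty) (∑-zero (signings τ)))
  where
  nonempty : ∀ s → [ dWord-aux (suc n) (ℤ.+ y ∷ s) == [] ]ᵇ * φ (ℤ.+ y ∷ s)
                   + ([ dWord-aux (suc n) (- ℤ.+ y ∷ s) == [] ]ᵇ * φ (- ℤ.+ y ∷ s) + 0) ≡ 0
  nonempty s with dWord-aux-skip n y s y>0 y≢
  ... | skip⁺ , skip⁻ rewrite skip⁺ | skip⁻ = refl

signings-d-skip-∷ : ∀ n y τ → 0 < y → ¬ y ≡ suc n → ∀ x xs (φ : List ℤ → ℕ) →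
  ∑ (signings (y ∷ τ)) (λ π → [ dWord-aux (suc n) π == (x ∷ xs) ]ᵇ * φ π)
    ≡ [ ⌊ y ℕ.≟ ∣ x ∣ ⌋ ]ᵇ * ∑ (signings τ) (λ s → [ dWord-aux (suc n) s == xs ]ᵇ * φ (x ∷ s))
signings-d-skip-∷ n y τ y>0 y≢ x xs φ =
  trans (∑-concatMap _ (signings τ) _) (trans (∑-cong (signings τ) choose) (∑-*ˡ (signings τ) [ ⌊ y ℕ.≟ ∣ x ∣ ⌋ ]ᵇ (λ s → g s x)))
  where
  g : List ℤ → ℤ → ℕ
  g s z = [ dWord-aux (suc n) s == xs ]ᵇ * φ (z ∷ s)
  choose : ∀ s → [ dWord-aux (suc n) (ℤ.+ y ∷ s) == (x ∷ xs) ]ᵇ * φ (ℤ.+ y ∷ s)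
                 + ([ dWord-aux (suc n) (- ℤ.+ y ∷ s) == (x ∷ xs) ]ᵇ * φ (- ℤ.+ y ∷ s) + 0)
                 ≡ [ ⌊ y ℕ.≟ ∣ x ∣ ⌋ ]ᵇ * g s x
  choose s with dWord-aux-skip n y s y>0 y≢
  ... | skip⁺ , skip⁻ rewrite skip⁺ | skip⁻ = begin
    [ (ℤ.+ y ∷ w) == (x ∷ xs) ]ᵇ * φ (ℤ.+ y ∷ s) + ([ (- ℤ.+ y ∷ w) == (x ∷ xs) ]ᵇ * φ (- ℤ.+ y ∷ s) + 0)
      ≡⟨ cong₂ _+_ (split (ℤ.+ y)) (trans (+-identityʳ _) (split (- ℤ.+ y))) ⟩
    [ ⌊ ℤ.+ y ℤ.≟ x ⌋ ]ᵇ * g s (ℤ.+ y) + [ ⌊ - ℤ.+ y ℤ.≟ x ⌋ ]ᵇ * g s (- ℤ.+ y)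
      ≡⟨ signed-choice y x (g s) y>0 ⟩
    [ ⌊ y ℕ.≟ ∣ x ∣ ⌋ ]ᵇ * g s x ∎
    where
    open ≡-Reasoning
    w : List ℤ
    w = dWord-aux (suc n) s
    split : ∀ z → [ (z ∷ w) == (x ∷ xs) ]ᵇ * φ (z ∷ s) ≡ [ ⌊ z ℤ.≟ x ⌋ ]ᵇ * g s z
    split z = trans (cong (_* φ (z ∷ s)) ([≡-dec]-∷ ℤ._≟_ z x w xs)) (*-assoc [ ⌊ z ℤ.≟ x ⌋ ]ᵇ [ w == xs ]ᵇ (φ (z ∷ s)))

insertAll-d : ∀ n σ → All (0 <_) σ → suc n ∉ σ → ∀ ρ (φ : List ℤ → ℕ) →
  ∑ (insertAll (suc n) σ) (λ τ → ∑ (signings τ) (λ π → [ dWord-aux (suc n) π == ρ ]ᵇ * φ π))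
    ≡ [ σ ==ℕ map ∣_∣ ρ ]ᵇ * ∑-preimages n φ ρ
insertAll-d n [] [] _ [] φ =
  trans (+-identityʳ _) (trans (signings-d-front n [] [] [] φ) (cong (1 *_) (sym (+-identityʳ _))))
insertAll-d n [] [] _ (x ∷ xs) φ = cong (_+ 0) (signings-d-front n [] [] (x ∷ xs) φ)
insertAll-d n (y ∷ ys) (y>0 ∷ ys>0) n+1∉ [] φ =
  cong₂ _+_ (signings-d-front n (y ∷ ys) (y>0 ∷ ys>0) [] φ)
            (trans (∑-map (y ∷_) (insertAll (suc n) ys) _)
                   (trans (∑-cong (insertAll (suc n) ys) (λ τ → signings-d-skip-[] n y τ y>0 y≢ φ))
                          (∑-zero (insertAll (suc n) ys))))
  where
  y≢ : ¬ y ≡ suc n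
  y≢ y≡ = n+1∉ (here (sym y≡))
insertAll-d n (y ∷ ys) (y>0 ∷ ys>0) n+1∉ (x ∷ xs) φ = begin
  ∑ (signings (suc n ∷ y ∷ ys)) (f (x ∷ xs)) + ∑ (map (y ∷_) (insertAll (suc n) ys)) (λ τ → ∑ (signings τ) (f (x ∷ xs)))
    ≡⟨ cong₂ _+_ (signings-d-front n (y ∷ ys) (y>0 ∷ ys>0) (x ∷ xs) φ) (∑-map (y ∷_) (insertAll (suc n) ys) _) ⟩
  [ (y ∷ ys) ==ℕ map ∣_∣ (x ∷ xs) ]ᵇ * A + ∑ (insertAll (suc n) ys) (λ τ → ∑ (signings (y ∷ τ)) (f (x ∷ xs)))
    ≡⟨ cong₂ _+_ (cong (_* A) ([≡-dec]-∷ ℕ._≟_ y ∣ x ∣ ys (map ∣_∣ xs)))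
                 (trans (∑-cong (insertAll (suc n) ys) (λ τ → signings-d-skip-∷ n y τ y>0 y≢ x xs φ))
                        (∑-*ˡ (insertAll (suc n) ys) δ _)) ⟩
  δ * c * A + δ * ∑ (insertAll (suc n) ys) (λ τ → ∑ (signings τ) (λ s → [ dWord-aux (suc n) s == xs ]ᵇ * φ (x ∷ s)))
    ≡⟨ cong (λ t → δ * c * A + δ * t) (insertAll-d n ys ys>0 (n+1∉ ∘ there) xs (φ ∘ (x ∷_))) ⟩
  δ * c * A + δ * (c * ∑-preimages n (φ ∘ (x ∷_)) xs)
    ≡⟨ factor δ c A _ ⟩
  δ * c * (A + ∑-preimages n (φ ∘ (x ∷_)) xs)
    ≡⟨ cong₂ _*_ (sym ([≡-dec]-∷ ℕ._≟_ y ∣ x ∣ ys (map ∣_∣ xs))) (sym (∑-preimages-∷ n φ x xs)) ⟩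
  [ (y ∷ ys) ==ℕ map ∣_∣ (x ∷ xs) ]ᵇ * ∑-preimages n φ (x ∷ xs) ∎
  where
  open ≡-Reasoning
  f : List ℤ → List ℤ → ℕ
  f ρ π = [ dWord-aux (suc n) π == ρ ]ᵇ * φ π
  A δ c : ℕ
  A = φ (ℤ.+ suc n ∷ x ∷ xs) + φ (-[1+ n ] ∷ map -_ (x ∷ xs))
  δ = [ ⌊ y ℕ.≟ ∣ x ∣ ⌋ ]ᵇ
  c = [ ys ==ℕ map ∣_∣ xs ]ᵇ
  y≢ : ¬ y ≡ suc n
  y≢ y≡ = n+1∉ (here (sym y≡))
  factor : ∀ a b u v → a * b * u + a * (b * v) ≡ a * b * (u + v)
  factor = solve-∀

d≡∑-preimages : ∀ F ρ → map ∣_∣ ρ ↭ upFrom 1 (length ρ) → d F ρ ≡ ∑-preimages (length ρ) F ρ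
d≡∑-preimages F ρ ρ↭ = begin
  ∑ (concatMap signings (concatMap (insertAll (suc L)) (perms L))) f
    ≡⟨ ∑-concatMap signings (concatMap (insertAll (suc L)) (perms L)) f ⟩
  ∑ (concatMap (insertAll (suc L)) (perms L)) (λ τ → ∑ (signings τ) f)
    ≡⟨ ∑-concatMap (insertAll (suc L)) (perms L) _ ⟩
  ∑ (perms L) (λ σ → ∑ (insertAll (suc L) σ) (λ τ → ∑ (signings τ) f))
    ≡⟨ ∑-cong-All (perms L) (perms-↭ L) remove-top ⟩
  ∑ (perms L) (λ σ → [ σ ==ℕ map ∣_∣ ρ ]ᵇ * ∑-preimages L F ρ)
    ≡⟨ ∑-*ʳ (perms L) _ _ ⟩
  ∑ (perms L) (λ σ → [ σ ==ℕ map ∣_∣ ρ ]ᵇ) * ∑-preimages L F ρ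
    ≡⟨ cong (_* ∑-preimages L F ρ) (perms-count L (map ∣_∣ ρ) ρ↭) ⟩
  1 * ∑-preimages L F ρ
    ≡⟨ *-identityˡ _ ⟩
  ∑-preimages L F ρ ∎
  where
  open ≡-Reasoning
  L : ℕ
  L = length ρ
  f : List ℤ → ℕ
  f π = if dWord π == ρ then F π else 0
  remove-top : ∀ σ → σ ↭ upFrom 1 L →
    ∑ (insertAll (suc L) σ) (λ τ → ∑ (signings τ) f) ≡ [ σ ==ℕ map ∣_∣ ρ ]ᵇ * ∑-preimages L F ρ
  remove-top σ σ↭ = trans (∑-cong-All (insertAll (suc L) σ) (insertAll-↭ (suc L) σ) (λ τ τ↭ →
                             ∑-cong-All (signings τ) (signings-length τ) (λ π ≡len → as-indicator π (length-π {π = π} τ↭ ≡len))))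
                          (insertAll-d L σ (upFrom-positive σ↭) (suc∉upFrom σ↭) ρ F)
    where
    length-π : ∀ {τ π} → τ ↭ suc L ∷ σ → length π ≡ length τ → length π ≡ suc L
    length-π τ↭ ≡len = trans ≡len (trans (↭-length τ↭) (cong suc (trans (↭-length σ↭) (length-upFrom 1 L))))
    as-indicator : ∀ π → length π ≡ suc L → f π ≡ [ dWord-aux (suc L) π == ρ ]ᵇ * F π
    as-indicator π ≡len = trans (if-then-else-[]ᵇ (dWord π == ρ) (F π)) (cong (λ m → [ dWord-aux m π == ρ ]ᵇ * F π) ≡len)

-- Alternating words

below-top : ∀ n x → ∣ x ∣ ≤ n → x ℤ.< ℤ.+ suc n
below-top n (ℤ.+ _)  ≤n = +<+ (s≤s ≤n)
below-top n -[1+ _ ] _  = -<+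

above-bottom : ∀ n x → ∣ x ∣ ≤ n → -[1+ n ] ℤ.< x
above-bottom n (ℤ.+ _)  _  = -<+
above-bottom n -[1+ _ ] ≤n = -<- ≤n

alt : Bool → List ℤ → Bool
alt true  = altUp
alt false = altDown

rel : Bool → ℤ → ℤ → Bool
rel true  x y = ⌊ x ℤ.<? y ⌋
rel false x y = ⌊ y ℤ.<? x ⌋

alt-∷∷ : ∀ b x y ys → alt b (x ∷ y ∷ ys) ≡ (rel b x y ∧ alt (not b) (y ∷ ys))
alt-∷∷ true  x y ys = refl
alt-∷∷ false x y ys = refl

not^ : ℕ → Bool → Bool
not^ zero    b = b
not^ (suc k) b = not (not^ k b)

not^-not : ∀ k b → not^ k (not b) ≡ not (not^ k b)
not^-not zero    b = refl
not^-not (suc k) b = cong not (not^-not k b)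

alt-split : ∀ (R : Bool → Bool) z w u a b → All (λ x → ∀ d → rel d x z ≡ R d) (a ∷ u) →
  alt b (a ∷ u ++ z ∷ w) ≡ (alt b (a ∷ u) ∧ (R (not^ (length u) b) ∧ alt (not (not^ (length u) b)) (z ∷ w)))
alt-split R z w []       a true  (Ra ∷ _)  = cong (_∧ altDown (z ∷ w)) (Ra true)
alt-split R z w []       a false (Ra ∷ _)  = cong (_∧ altUp (z ∷ w)) (Ra false)
alt-split R z w (a′ ∷ u) a b     (_ ∷ Ru) = begin
  alt b (a ∷ a′ ∷ u ++ z ∷ w)
    ≡⟨ alt-∷∷ b a a′ (u ++ z ∷ w) ⟩
  rel b a a′ ∧ alt (not b) (a′ ∷ u ++ z ∷ w)
    ≡⟨ cong (rel b a a′ ∧_) (alt-split R z w u a′ (not b) Ru) ⟩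
  rel b a a′ ∧ (alt (not b) (a′ ∷ u) ∧ (R (not^ (length u) (not b)) ∧ alt (not (not^ (length u) (not b))) (z ∷ w)))
    ≡⟨ cong (λ t → rel b a a′ ∧ (alt (not b) (a′ ∷ u) ∧ (R t ∧ alt (not t) (z ∷ w)))) (not^-not (length u) b) ⟩
  rel b a a′ ∧ (alt (not b) (a′ ∷ u) ∧ rest)
    ≡⟨ sym (∧-assoc (rel b a a′) _ _) ⟩
  (rel b a a′ ∧ alt (not b) (a′ ∷ u)) ∧ rest
    ≡⟨ cong (_∧ rest) (sym (alt-∷∷ b a a′ u)) ⟩
  alt b (a ∷ a′ ∷ u) ∧ rest ∎
  where
  open ≡-Reasoning
  rest : Bool
  rest = R (not^ (suc (length u)) b) ∧ alt (not (not^ (suc (length u)) b)) (z ∷ w)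

rel-top : ∀ n x → ∣ x ∣ ≤ n → ∀ d → rel d x (ℤ.+ suc n) ≡ d
rel-top n x ∣x∣≤n true  = ⌊ x ℤ.<? ℤ.+ suc n ⌋-yes (below-top n x ∣x∣≤n)
rel-top n x ∣x∣≤n false = ⌊ ℤ.+ suc n ℤ.<? x ⌋-no (ℤ.<-asym (below-top n x ∣x∣≤n))

rel-bottom : ∀ n x → ∣ x ∣ ≤ n → ∀ d → rel d x -[1+ n ] ≡ not d
rel-bottom n x ∣x∣≤n true  = ⌊ x ℤ.<? -[1+ n ] ⌋-no (ℤ.<-asym (above-bottom n x ∣x∣≤n))
rel-bottom n x ∣x∣≤n false = ⌊ -[1+ n ] ℤ.<? x ⌋-yes (above-bottom n x ∣x∣≤n)

bounded-neg : ∀ {n v} → All (λ x → ∣ x ∣ ≤ n) v → All (λ x → ∣ x ∣ ≤ n) (map -_ v)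
bounded-neg {n} = All.map⁺ ∘ All.map (λ {y} → subst (_≤ n) (sym (ℤ.∣-i∣≡∣i∣ y)))

altDown-top : ∀ n v → All (λ x → ∣ x ∣ ≤ n) v → altDown (ℤ.+ suc n ∷ v) ≡ altUp v
altDown-top n []      _          = refl
altDown-top n (y ∷ v) (∣y∣≤n ∷ _) = cong (_∧ altUp (y ∷ v)) (rel-top n y ∣y∣≤n true)

altUp-top : ∀ n y v → ∣ y ∣ ≤ n → altUp (ℤ.+ suc n ∷ y ∷ v) ≡ false
altUp-top n y v ∣y∣≤n = cong (_∧ altDown (y ∷ v)) (rel-top n y ∣y∣≤n false)

altUp-bottom : ∀ n w → All (λ x → ∣ x ∣ ≤ n) w → altUp (-[1+ n ] ∷ w) ≡ altDown w
altUp-bottom n []      _          = refl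
altUp-bottom n (y ∷ w) (∣y∣≤n ∷ _) = cong (_∧ altDown (y ∷ w)) (rel-bottom n y ∣y∣≤n false)

rel-neg : ∀ b x y → rel b (- x) (- y) ≡ rel (not b) x y
rel-neg true  x y = neg-< x y
  where
  neg-< : ∀ x y → ⌊ - x ℤ.<? - y ⌋ ≡ ⌊ y ℤ.<? x ⌋
  neg-< x y with y ℤ.<? x
  ... | yes y<x = ⌊ - x ℤ.<? - y ⌋-yes (ℤ.neg-mono-< y<x)
  ... | no  y≮x = ⌊ - x ℤ.<? - y ⌋-no (y≮x ∘ ℤ.neg-cancel-<)
rel-neg false x y = rel-neg true y x

alt-neg : ∀ b v → alt b (map -_ v) ≡ alt (not b) v
alt-neg true  []          = refl
alt-neg false []          = refl
alt-neg true  (x ∷ [])    = refl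
alt-neg false (x ∷ [])    = refl
alt-neg b     (x ∷ y ∷ v) = begin
  alt b (- x ∷ - y ∷ map -_ v)
    ≡⟨ alt-∷∷ b (- x) (- y) (map -_ v) ⟩
  rel b (- x) (- y) ∧ alt (not b) (map -_ (y ∷ v))
    ≡⟨ cong₂ _∧_ (rel-neg b x y) (alt-neg (not b) (y ∷ v)) ⟩
  rel (not b) x y ∧ alt (not (not b)) (y ∷ v)
    ≡⟨ sym (alt-∷∷ (not b) x y v) ⟩
  alt (not b) (x ∷ y ∷ v) ∎
  where open ≡-Reasoning

lift-front : ∀ n ρ → All (λ x → ∣ x ∣ ≤ n) ρ →
  X (insert⁺ n 0 ρ) + X (insert⁻ n 0 ρ) ≡ one ρ + X [] * X ρ
lift-front n []       _               = refl
lift-front n (x ∷ xs) ρ≤@(∣x∣≤n ∷ _) = begin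
  [ altUp (ℤ.+ suc n ∷ x ∷ xs) ]ᵇ + [ altUp (-[1+ n ] ∷ map -_ (x ∷ xs)) ]ᵇ
    ≡⟨ cong₂ (λ a b → [ a ]ᵇ + [ b ]ᵇ) (altUp-top n x xs ∣x∣≤n) (altUp-bottom n (map -_ (x ∷ xs)) (bounded-neg ρ≤)) ⟩
  [ altDown (map -_ (x ∷ xs)) ]ᵇ
    ≡⟨ cong [_]ᵇ (alt-neg false (x ∷ xs)) ⟩
  [ altUp (x ∷ xs) ]ᵇ
    ≡⟨ sym (*-identityˡ _) ⟩
  1 * [ altUp (x ∷ xs) ]ᵇ ∎
  where open ≡-Reasoning

-- Position k+1 of the lift must be a peak or a valley according to the parity of k; n+1 can
-- only be a peak and −(n+1) only a valley, so exactly one of the two lifts can alternate.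
lift-inner : ∀ n x xs → All (λ y → ∣ y ∣ ≤ n) (x ∷ xs) → ∀ k →
  X (insert⁺ n (suc k) (x ∷ xs)) + X (insert⁻ n (suc k) (x ∷ xs)) ≡ X (take (suc k) (x ∷ xs)) * X (drop (suc k) (x ∷ xs))
lift-inner n x xs (∣x∣≤n ∷ xs≤) k = by-parity (not^ (length u) true) refl
  where
  u v : List ℤ
  u = take k xs
  v = drop k xs
  u≤ : All (λ y → ∣ y ∣ ≤ n) (x ∷ u)
  u≤ = ∣x∣≤n ∷ All.take⁺ k xs≤
  v≤ : All (λ y → ∣ y ∣ ≤ n) v
  v≤ = All.drop⁺ k xs≤
  split⁺ : altUp (x ∷ u ++ ℤ.+ suc n ∷ v)
         ≡ (altUp (x ∷ u) ∧ (not^ (length u) true ∧ alt (not (not^ (length u) true)) (ℤ.+ suc n ∷ v)))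
  split⁺ = alt-split id (ℤ.+ suc n) v u x true (All.map (λ {y} → rel-top n y) u≤)
  split⁻ : altUp (x ∷ u ++ -[1+ n ] ∷ map -_ v)
         ≡ (altUp (x ∷ u) ∧ (not (not^ (length u) true) ∧ alt (not (not^ (length u) true)) (-[1+ n ] ∷ map -_ v)))
  split⁻ = alt-split not -[1+ n ] (map -_ v) u x true (All.map (λ {y} → rel-bottom n y) u≤)
  by-parity : ∀ f → not^ (length u) true ≡ f →
    [ altUp (x ∷ u ++ ℤ.+ suc n ∷ v) ]ᵇ + [ altUp (x ∷ u ++ -[1+ n ] ∷ map -_ v) ]ᵇ ≡ [ altUp (x ∷ u) ]ᵇ * [ altUp v ]ᵇ
  by-parity true  e rewrite split⁺ | split⁻ | e | altDown-top n v v≤ | ∧-zeroʳ (altUp (x ∷ u)) =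
    trans (+-identityʳ _) ([∧]ᵇ (altUp (x ∷ u)) (altUp v))
  by-parity false e rewrite split⁺ | split⁻ | e | altUp-bottom n (map -_ v) (bounded-neg v≤) | alt-neg false v
                          | ∧-zeroʳ (altUp (x ∷ u)) =
    [∧]ᵇ (altUp (x ∷ u)) (altUp v)

∑-splits : (List ℤ → ℕ) → (List ℤ → ℕ) → List ℤ → ℕ
∑-splits F G ρ = ∑ (upTo (suc (length ρ))) (λ k → F (take k ρ) * G (drop k ρ))

∑-preimages-X : ∀ n ρ → All (λ x → ∣ x ∣ ≤ n) ρ → ∑-preimages n X ρ ≡ one ρ + ∑-splits X X ρ
∑-preimages-X n []       _  = refl
∑-preimages-X n (x ∷ xs) ρ≤ = begin
  ∑-preimages n X (x ∷ xs)
    ≡⟨ ∑-upTo-suc (suc (length xs)) lifts ⟩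
  lifts 0 + ∑ (upTo (suc (length xs))) (lifts ∘ suc)
    ≡⟨ cong₂ _+_ (lift-front n (x ∷ xs) ρ≤) (∑-cong (upTo (suc (length xs))) (lift-inner n x xs ρ≤)) ⟩
  one (x ∷ xs) + X [] * X (x ∷ xs) + ∑ (upTo (suc (length xs))) (split ∘ suc)
    ≡⟨ +-assoc (one (x ∷ xs)) (split 0) _ ⟩
  one (x ∷ xs) + (split 0 + ∑ (upTo (suc (length xs))) (split ∘ suc))
    ≡⟨ cong (one (x ∷ xs) +_) (sym (∑-upTo-suc (suc (length xs)) split)) ⟩
  one (x ∷ xs) + ∑-splits X X (x ∷ xs) ∎
  where
  open ≡-Reasoning
  lifts split : ℕ → ℕ
  lifts k = X (insert⁺ n k (x ∷ xs)) + X (insert⁻ n k (x ∷ xs))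
  split k = X (take k (x ∷ xs)) * X (drop k (x ∷ xs))

-- Standardisation

<ᵇ-yes : ∀ {m n} → m < n → (m <ℕᵇ n) ≡ true
<ᵇ-yes {m} {n} m<n with m <ℕᵇ n | <⇒<ᵇ m<n
... | true | _ = refl

<ᵇ-no : ∀ {m n} → ¬ m < n → (m <ℕᵇ n) ≡ false
<ᵇ-no {m} {n} m≮n with m <ℕᵇ n in eq
... | true  = ⊥-elim (m≮n (<ᵇ⇒< m n (subst T (sym eq) tt)))
... | false = refl

<ᵇ-indicator-mono : ∀ z {x y} → x ≤ y → (if z <ℕᵇ x then 1 else 0) ≤ (if z <ℕᵇ y then 1 else 0)
<ᵇ-indicator-mono z {x} {y} x≤y with z <ℕᵇ x in eq
... | false = z≤n
... | true rewrite <ᵇ-yes (<-≤-trans (<ᵇ⇒< z x (subst T (sym eq) tt)) x≤y) = ≤-refl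

countLess-mono : ∀ {x y} w → x ≤ y → countLess x w ≤ countLess y w
countLess-mono []      x≤y = z≤n
countLess-mono (z ∷ w) x≤y = +-mono-≤ (<ᵇ-indicator-mono z x≤y) (countLess-mono w x≤y)

countLess-< : ∀ {x y} w → y ∈ w → y < x → countLess y w < countLess x w
countLess-< {x} {y} (z ∷ w) (here refl) y<x rewrite <ᵇ-no (<-irrefl {y} refl) | <ᵇ-yes y<x =
  s≤s (countLess-mono w (<⇒≤ y<x))
countLess-< (z ∷ w) (there y∈) y<x = +-mono-≤-< (<ᵇ-indicator-mono z (<⇒≤ y<x)) (countLess-< w y∈ y<x)

countLess≤length : ∀ x w → countLess x w ≤ length w
countLess≤length x []      = z≤n
countLess≤length x (z ∷ w) = +-mono-≤ (indicator≤1 (z <ℕᵇ x)) (countLess≤length x w)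
  where
  indicator≤1 : ∀ b → (if b then 1 else 0) ≤ 1
  indicator≤1 true  = ≤-refl
  indicator≤1 false = z≤n

shift : ℕ → ℕ → ℕ
shift c t = if ⌊ t ℕ.≤? c ⌋ then t else suc t

map-shift-upFrom : ∀ c a L → c < a → map (shift c) (upFrom a L) ≡ upFrom (suc a) L
map-shift-upFrom c a zero    c<a = refl
map-shift-upFrom c a (suc L) c<a rewrite ⌊ a ℕ.≤? c ⌋-no (<⇒≱ c<a) =
  cong (suc a ∷_) (map-shift-upFrom c (suc a) L (m<n⇒m<1+n c<a))

shift-↭ : ∀ c a L → a ≤ suc c → suc c ≤ a + L → suc c ∷ map (shift c) (upFrom a L) ↭ upFrom a (suc L)
shift-↭ c a zero    a≤ ≤a+L with ≤-antisym a≤ (subst (suc c ≤_) (+-identityʳ a) ≤a+L)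
... | refl = ↭-refl
shift-↭ c a (suc L) a≤ ≤a+L with a ℕ.≤? c
... | yes a≤c = ↭-trans (swap (suc c) a ↭-refl) (prep a (shift-↭ c (suc a) L (s≤s a≤c) (subst (suc c ≤_) (+-suc a L) ≤a+L)))
... | no a≰c with ≤-antisym a≤ (≰⇒> a≰c)
...   | refl = prep (suc c) (prep (suc (suc c)) (↭-reflexive (map-shift-upFrom c (suc (suc c)) L (m<n⇒m<1+n ≤-refl))))

std-∷ : ∀ x w → x ∉ w → std (x ∷ w) ≡ suc (countLess x w) ∷ map (shift (countLess x w)) (std w)
std-∷ x w x∉w rewrite <ᵇ-no (<-irrefl {x} refl) =
  cong (suc c ∷_) (trans (map-cong-∈ w (λ {y} → shift-count y)) (map-∘ w))
  where
  c : ℕ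
  c = countLess x w
  map-cong-∈ : ∀ v {f g : ℕ → ℕ} → (∀ {y} → y ∈ v → f y ≡ g y) → map f v ≡ map g v
  map-cong-∈ []      f≗g = refl
  map-cong-∈ (y ∷ v) f≗g = cong₂ _∷_ (f≗g (here refl)) (map-cong-∈ v (f≗g ∘ there))
  shift-count : ∀ y → y ∈ w → suc (countLess y (x ∷ w)) ≡ shift c (suc (countLess y w))
  shift-count y y∈ with <-cmp x y
  ... | tri< x<y _ _ rewrite <ᵇ-yes x<y | ⌊ suc (countLess y w) ℕ.≤? c ⌋-no (λ ≤c → <⇒≱ ≤c (countLess-mono w (<⇒≤ x<y))) = refl
  ... | tri≈ _ refl _ = ⊥-elim (x∉w y∈)
  ... | tri> _ _ y<x rewrite <ᵇ-no (<⇒≯ y<x) | ⌊ suc (countLess y w) ℕ.≤? c ⌋-yes (countLess-< w y∈ y<x) = refl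

std-↭ : ∀ w → Unique w → std w ↭ upFrom 1 (length w)
std-↭ []      []          = ↭-refl
std-↭ (x ∷ w) (x∉ ∷ uniq) = begin
  std (x ∷ w)                                          ≡⟨ std-∷ x w (λ x∈ → All.lookup x∉ x∈ refl) ⟩
  suc c ∷ map (shift c) (std w)                        ↭⟨ prep (suc c) (map⁺ (shift c) (std-↭ w uniq)) ⟩
  suc c ∷ map (shift c) (upFrom 1 (length w))          ↭⟨ shift-↭ c 1 (length w) (s≤s z≤n) (s≤s (countLess≤length x w)) ⟩
  upFrom 1 (suc (length w))                            ∎
  where
  open PermutationReasoning
  c : ℕ
  c = countLess x w

signedStdLetter : List ℕ → ℤ → ℤ
signedStdLetter W x = sign x ◃ suc (countLess ∣ x ∣ W)

signedStd : List ℤ → List ℤ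
signedStd u = map (signedStdLetter (map ∣_∣ u)) u

map-abs-signedStd : ∀ u → map ∣_∣ (signedStd u) ≡ std (map ∣_∣ u)
map-abs-signedStd u = begin
  map ∣_∣ (map (signedStdLetter W) u)                ≡⟨ sym (map-∘ u) ⟩
  map (λ x → ∣ signedStdLetter W x ∣) u              ≡⟨ map-cong (λ x → ℤ.abs-◃ (sign x) _) u ⟩
  map (λ x → suc (countLess ∣ x ∣ W)) u              ≡⟨ map-∘ u ⟩
  std W                                              ∎
  where
  open ≡-Reasoning
  W : List ℕ
  W = map ∣_∣ u

map-sign-signedStd : ∀ u → map sign (signedStd u) ≡ map sign u
map-sign-signedStd u = trans (sym (map-∘ u)) (map-cong (λ x → ℤ.sign-◃ (sign x) (suc (countLess ∣ x ∣ (map ∣_∣ u)))) u)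

signedLess : Sign → Sign → Bool → Bool → Bool
signedLess Sign.+ Sign.+ m<n n<m = m<n
signedLess Sign.- Sign.- m<n n<m = n<m
signedLess Sign.- Sign.+ _   _   = true
signedLess Sign.+ Sign.- _   _   = false

<-by-sign-abs : ∀ x y → 0 < ∣ x ∣ → 0 < ∣ y ∣ →
  ⌊ x ℤ.<? y ⌋ ≡ signedLess (sign x) (sign y) ⌊ ∣ x ∣ ℕ.<? ∣ y ∣ ⌋ ⌊ ∣ y ∣ ℕ.<? ∣ x ∣ ⌋
<-by-sign-abs (ℤ.+ suc m) (ℤ.+ suc n) _ _ = ⌊⌋-cong (ℤ.+ suc m ℤ.<? ℤ.+ suc n) (suc m ℕ.<? suc n) ℤ.drop‿+<+ +<+
<-by-sign-abs (ℤ.+ suc m) -[1+ n ]    _ _ = ⌊ ℤ.+ suc m ℤ.<? -[1+ n ] ⌋-no (λ ())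
<-by-sign-abs -[1+ m ]    (ℤ.+ suc n) _ _ = ⌊ -[1+ m ] ℤ.<? ℤ.+ suc n ⌋-yes -<+
<-by-sign-abs -[1+ m ]    -[1+ n ]    _ _ =
  ⌊⌋-cong (-[1+ m ] ℤ.<? -[1+ n ]) (suc n ℕ.<? suc m) (s≤s ∘ ℤ.drop‿-<-) (-<- ∘ ≤-pred)

countLess-<? : ∀ {a b} W → a ∈ W → b ∈ W → ⌊ suc (countLess a W) ℕ.<? suc (countLess b W) ⌋ ≡ ⌊ a ℕ.<? b ⌋
countLess-<? {a} {b} W a∈ b∈ with <-cmp a b
... | tri< a<b _ _   = trans (⌊ _ ℕ.<? _ ⌋-yes (s≤s (countLess-< W a∈ a<b))) (sym (⌊ a ℕ.<? b ⌋-yes a<b))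
... | tri≈ _ refl _  = trans (⌊ _ ℕ.<? _ ⌋-no (<-irrefl refl)) (sym (⌊ a ℕ.<? a ⌋-no (<-irrefl refl)))
... | tri> _ _ b<a   = trans (⌊ _ ℕ.<? _ ⌋-no (<⇒≯ (s≤s (countLess-< W b∈ b<a)))) (sym (⌊ a ℕ.<? b ⌋-no (<⇒≯ b<a)))

alt-map : ∀ (f : ℤ → ℤ) u → (∀ {x y} → x ∈ u → y ∈ u → ⌊ f x ℤ.<? f y ⌋ ≡ ⌊ x ℤ.<? y ⌋) →
  ∀ b → alt b (map f u) ≡ alt b u
alt-map f []          _     true  = refl
alt-map f []          _     false = refl
alt-map f (x ∷ [])    _     true  = refl
alt-map f (x ∷ [])    _     false = refl
alt-map f (x ∷ y ∷ u) f-mon b     = begin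
  alt b (f x ∷ f y ∷ map f u)                ≡⟨ alt-∷∷ b (f x) (f y) (map f u) ⟩
  rel b (f x) (f y) ∧ alt (not b) (map f (y ∷ u))
    ≡⟨ cong₂ _∧_ (rel-f b) (alt-map f (y ∷ u) (λ x∈ y∈ → f-mon (there x∈) (there y∈)) (not b)) ⟩
  rel b x y ∧ alt (not b) (y ∷ u)            ≡⟨ sym (alt-∷∷ b x y u) ⟩
  alt b (x ∷ y ∷ u)                          ∎
  where
  open ≡-Reasoning
  rel-f : ∀ b → rel b (f x) (f y) ≡ rel b x y
  rel-f true  = f-mon (here refl) (there (here refl))
  rel-f false = f-mon (there (here refl)) (here refl)

altUp-signedStd : ∀ u → All (λ x → 0 < ∣ x ∣) u → altUp (signedStd u) ≡ altUp u
altUp-signedStd u u>0 = alt-map f u f-mon true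
  where
  W : List ℕ
  W = map ∣_∣ u
  f : ℤ → ℤ
  f = signedStdLetter W
  ∣f∣ : ∀ x → ∣ f x ∣ ≡ suc (countLess ∣ x ∣ W)
  ∣f∣ x = ℤ.abs-◃ (sign x) _
  f>0 : ∀ x → 0 < ∣ f x ∣
  f>0 x = subst (0 <_) (sym (∣f∣ x)) (s≤s z≤n)
  compare : ∀ {a b} → a ∈ u → b ∈ u → ⌊ ∣ f a ∣ ℕ.<? ∣ f b ∣ ⌋ ≡ ⌊ ∣ a ∣ ℕ.<? ∣ b ∣ ⌋
  compare {a} {b} a∈ b∈ = trans (cong₂ (λ m n → ⌊ m ℕ.<? n ⌋) (∣f∣ a) (∣f∣ b))
                                (countLess-<? W (∈-map⁺ ∣_∣ a∈) (∈-map⁺ ∣_∣ b∈))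
  f-mon : ∀ {x y} → x ∈ u → y ∈ u → ⌊ f x ℤ.<? f y ⌋ ≡ ⌊ x ℤ.<? y ⌋
  f-mon {x} {y} x∈ y∈ = begin
    ⌊ f x ℤ.<? f y ⌋
      ≡⟨ <-by-sign-abs (f x) (f y) (f>0 x) (f>0 y) ⟩
    signedLess (sign (f x)) (sign (f y)) ⌊ ∣ f x ∣ ℕ.<? ∣ f y ∣ ⌋ ⌊ ∣ f y ∣ ℕ.<? ∣ f x ∣ ⌋
      ≡⟨ cong₂ (λ s t → signedLess s t ⌊ ∣ f x ∣ ℕ.<? ∣ f y ∣ ⌋ ⌊ ∣ f y ∣ ℕ.<? ∣ f x ∣ ⌋)
               (ℤ.sign-◃ (sign x) _) (ℤ.sign-◃ (sign y) _) ⟩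
    signedLess (sign x) (sign y) ⌊ ∣ f x ∣ ℕ.<? ∣ f y ∣ ⌋ ⌊ ∣ f y ∣ ℕ.<? ∣ f x ∣ ⌋
      ≡⟨ cong₂ (signedLess (sign x) (sign y)) (compare x∈ y∈) (compare y∈ x∈) ⟩
    signedLess (sign x) (sign y) ⌊ ∣ x ∣ ℕ.<? ∣ y ∣ ⌋ ⌊ ∣ y ∣ ℕ.<? ∣ x ∣ ⌋
      ≡⟨ sym (<-by-sign-abs x y (All.lookup u>0 x∈) (All.lookup u>0 y∈)) ⟩
    ⌊ x ℤ.<? y ⌋ ∎
    where open ≡-Reasoning

-- The coefficients of F ⊗ G

take-length-++ : {A : Set} (xs ys : List A) → take (length xs) (xs ++ ys) ≡ xs
take-length-++ []       ys = refl
take-length-++ (x ∷ xs) ys = cong (x ∷_) (take-length-++ xs ys)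

drop-length-++ : {A : Set} (xs ys : List A) → drop (length xs) (xs ++ ys) ≡ ys
drop-length-++ []       ys = refl
drop-length-++ (x ∷ xs) ys = drop-length-++ xs ys

sign-abs-injective : ∀ {α β} → map sign α ≡ map sign β → map ∣_∣ α ≡ map ∣_∣ β → α ≡ β
sign-abs-injective {[]}    {[]}    _     _     = refl
sign-abs-injective {x ∷ α} {y ∷ β} signs≡ abss≡ =
  cong₂ _∷_ (ℤ.◃-cong (∷-injectiveˡ signs≡) (∷-injectiveˡ abss≡)) (sign-abs-injective (∷-injectiveʳ signs≡) (∷-injectiveʳ abss≡))

inProduct-sound : ∀ α β ρ → inProduct α β ρ ≡ 1 →
  α ≡ signedStd (take (length α) ρ) × β ≡ signedStd (drop (length α) ρ)
inProduct-sound α β ρ ≡1 = sign-abs-injective signα absα , sign-abs-injective signβ absβ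
  where
  k : ℕ
  k = length α
  b₁ b₂ b₃ : Bool
  b₁ = std (take k (map ∣_∣ ρ)) ==ℕ map ∣_∣ α
  b₂ = std (drop k (map ∣_∣ ρ)) ==ℕ map ∣_∣ β
  b₃ = map sign ρ ==S (map sign α ++ map sign β)
  all-true : b₁ ∧ b₂ ∧ b₃ ≡ true
  all-true = []ᵇ≡1⇒≡true ≡1
  std-take : std (take k (map ∣_∣ ρ)) ≡ map ∣_∣ α
  std-take = ⌊ ≡-dec ℕ._≟_ _ _ ⌋-sound (∧-conicalˡ b₁ _ all-true)
  std-drop : std (drop k (map ∣_∣ ρ)) ≡ map ∣_∣ β
  std-drop = ⌊ ≡-dec ℕ._≟_ _ _ ⌋-sound (∧-conicalˡ b₂ _ (∧-conicalʳ b₁ _ all-true))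
  signs : map sign ρ ≡ map sign α ++ map sign β
  signs = ⌊ ≡-dec Sign._≟_ _ _ ⌋-sound (∧-conicalʳ b₂ _ (∧-conicalʳ b₁ _ all-true))
  k≡ : length (map sign α) ≡ k
  k≡ = length-map sign α
  absα : map ∣_∣ α ≡ map ∣_∣ (signedStd (take k ρ))
  absα = sym (trans (map-abs-signedStd (take k ρ)) (trans (cong std (sym (take-map k ρ))) std-take))
  absβ : map ∣_∣ β ≡ map ∣_∣ (signedStd (drop k ρ))
  absβ = sym (trans (map-abs-signedStd (drop k ρ)) (trans (cong std (sym (drop-map k ρ))) std-drop))
  signα : map sign α ≡ map sign (signedStd (take k ρ))
  signα = begin
    map sign α                                       ≡⟨ sym (take-length-++ (map sign α) (map sign β)) ⟩
    take (length (map sign α)) (map sign α ++ map sign β) ≡⟨ cong₂ take k≡ (sym signs) ⟩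
    take k (map sign ρ)                              ≡⟨ take-map k ρ ⟩
    map sign (take k ρ)                              ≡⟨ sym (map-sign-signedStd (take k ρ)) ⟩
    map sign (signedStd (take k ρ))                  ∎
    where open ≡-Reasoning
  signβ : map sign β ≡ map sign (signedStd (drop k ρ))
  signβ = begin
    map sign β                                       ≡⟨ sym (drop-length-++ (map sign α) (map sign β)) ⟩
    drop (length (map sign α)) (map sign α ++ map sign β) ≡⟨ cong₂ drop k≡ (sym signs) ⟩
    drop k (map sign ρ)                              ≡⟨ drop-map k ρ ⟩
    map sign (drop k ρ)                              ≡⟨ sym (map-sign-signedStd (drop k ρ)) ⟩
    map sign (signedStd (drop k ρ))                  ∎
    where open ≡-Reasoning

length-signedStd-take : ∀ ρ k → k ≤ length ρ → length (signedStd (take k ρ)) ≡ k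
length-signedStd-take ρ k k≤ = trans (length-map _ (take k ρ)) (trans (length-take k ρ) (m≤n⇒m⊓n≡m k≤))

inProduct-signedStd : ∀ ρ k → k ≤ length ρ → inProduct (signedStd (take k ρ)) (signedStd (drop k ρ)) ρ ≡ 1
inProduct-signedStd ρ k k≤ =
  cong [_]ᵇ (cong₂ _∧_ (⌊ ≡-dec ℕ._≟_ _ _ ⌋-yes std-take)
           (cong₂ _∧_ (⌊ ≡-dec ℕ._≟_ _ _ ⌋-yes std-drop) (⌊ ≡-dec Sign._≟_ _ _ ⌋-yes signs)))
  where
  α₀ β₀ : List ℤ
  α₀ = signedStd (take k ρ)
  β₀ = signedStd (drop k ρ)
  std-take : std (take (length α₀) (map ∣_∣ ρ)) ≡ map ∣_∣ α₀
  std-take = trans (cong (λ j → std (take j (map ∣_∣ ρ))) (length-signedStd-take ρ k k≤))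
                   (trans (cong std (take-map k ρ)) (sym (map-abs-signedStd (take k ρ))))
  std-drop : std (drop (length α₀) (map ∣_∣ ρ)) ≡ map ∣_∣ β₀
  std-drop = trans (cong (λ j → std (drop j (map ∣_∣ ρ))) (length-signedStd-take ρ k k≤))
                   (trans (cong std (drop-map k ρ)) (sym (map-abs-signedStd (drop k ρ))))
  signs : map sign ρ ≡ map sign α₀ ++ map sign β₀
  signs = begin
    map sign ρ                                ≡⟨ cong (map sign) (sym (take++drop≡id k ρ)) ⟩
    map sign (take k ρ ++ drop k ρ)           ≡⟨ map-++ sign (take k ρ) (drop k ρ) ⟩
    map sign (take k ρ) ++ map sign (drop k ρ) ≡⟨ sym (cong₂ _++_ (map-sign-signedStd (take k ρ)) (map-sign-signedStd (drop k ρ))) ⟩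
    map sign α₀ ++ map sign β₀                ∎
    where open ≡-Reasoning

inProduct-split : ∀ ρ k α β → k ≤ length ρ → length α ≡ k →
  inProduct α β ρ ≡ [ α == signedStd (take k ρ) ]ᵇ * [ β == signedStd (drop k ρ) ]ᵇ
inProduct-split ρ k α β k≤ ∣α∣≡k with ≡-dec ℤ._≟_ α (signedStd (take k ρ)) | ≡-dec ℤ._≟_ β (signedStd (drop k ρ))
... | yes refl | yes refl = inProduct-signedStd ρ k k≤
... | no α≢    | _        = []ᵇ≢1⇒≡0 (α≢ ∘ subst (λ j → α ≡ signedStd (take j ρ)) ∣α∣≡k ∘ proj₁ ∘ inProduct-sound α β ρ)
... | yes refl | no β≢    = []ᵇ≢1⇒≡0 (β≢ ∘ subst (λ j → β ≡ signedStd (drop j ρ)) ∣α∣≡k ∘ proj₂ ∘ inProduct-sound α β ρ)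

signedStd-↭ : ∀ u → Unique (map ∣_∣ u) → map ∣_∣ (signedStd u) ↭ upFrom 1 (length u)
signedStd-↭ u uniq = subst₂ _↭_ (sym (map-abs-signedStd u)) (cong (upFrom 1) (length-map ∣_∣ u)) (std-↭ (map ∣_∣ u) uniq)

∑-inProduct : ∀ (F G : Series) ρ → Unique (map ∣_∣ ρ) → ∀ k → k ≤ length ρ →
  ∑ (signedPerms k) (λ α → ∑ (signedPerms (length ρ ∸ k)) (λ β → F α * G β * inProduct α β ρ))
    ≡ F (signedStd (take k ρ)) * G (signedStd (drop k ρ))
∑-inProduct F G ρ uniq k k≤ = begin
  ∑ (signedPerms k) (λ α → ∑ (signedPerms (length ρ ∸ k)) (λ β → F α * G β * inProduct α β ρ))
    ≡⟨ ∑-cong-All (signedPerms k) (signedPerms-length k) (λ α ∣α∣≡k → ∑-cong (signedPerms (length ρ ∸ k)) (λ β →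
         trans (cong (F α * G β *_) (inProduct-split ρ k α β k≤ ∣α∣≡k)) (regroup (F α) (G β) [ α == α₀ ]ᵇ [ β == β₀ ]ᵇ))) ⟩
  ∑ (signedPerms k) (λ α → ∑ (signedPerms (length ρ ∸ k)) (λ β → [ α == α₀ ]ᵇ * ([ β == β₀ ]ᵇ * (F α * G β))))
    ≡⟨ ∑-cong (signedPerms k) (λ α → ∑-*ˡ (signedPerms (length ρ ∸ k)) [ α == α₀ ]ᵇ _) ⟩
  ∑ (signedPerms k) (λ α → [ α == α₀ ]ᵇ * ∑ (signedPerms (length ρ ∸ k)) (λ β → [ β == β₀ ]ᵇ * (F α * G β)))
    ≡⟨ ∑-cong (signedPerms k) (λ α → cong ([ α == α₀ ]ᵇ *_) (signedPerms-pick (length ρ ∸ k) β₀ (λ β → F α * G β) β₀↭)) ⟩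
  ∑ (signedPerms k) (λ α → [ α == α₀ ]ᵇ * (F α * G β₀))
    ≡⟨ signedPerms-pick k α₀ (λ α → F α * G β₀) α₀↭ ⟩
  F α₀ * G β₀ ∎
  where
  open ≡-Reasoning
  α₀ β₀ : List ℤ
  α₀ = signedStd (take k ρ)
  β₀ = signedStd (drop k ρ)
  regroup : ∀ a b c e → a * b * (c * e) ≡ c * (e * (a * b))
  regroup = solve-∀
  α₀↭ : map ∣_∣ α₀ ↭ upFrom 1 k
  α₀↭ = subst (λ j → map ∣_∣ α₀ ↭ upFrom 1 j) (trans (length-take k ρ) (m≤n⇒m⊓n≡m k≤))
          (signedStd-↭ (take k ρ) (subst Unique (take-map k ρ) (Unique.take⁺ k uniq)))
  β₀↭ : map ∣_∣ β₀ ↭ upFrom 1 (length ρ ∸ k)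
  β₀↭ = subst (λ j → map ∣_∣ β₀ ↭ upFrom 1 j) (length-drop k ρ)
          (signedStd-↭ (drop k ρ) (subst Unique (drop-map k ρ) (Unique.drop⁺ k uniq)))

⊗≡∑-splits : ∀ (F G : Series) ρ → Unique (map ∣_∣ ρ) → (F ⊗ G) ρ ≡ ∑-splits (F ∘ signedStd) (G ∘ signedStd) ρ
⊗≡∑-splits F G ρ uniq = ∑-cong-All (upTo (suc (length ρ))) (All.applyUpTo⁺₁ id (suc (length ρ)) ≤-pred) (∑-inProduct F G ρ uniq)

X∘signedStd : ∀ u → All (λ x → 0 < ∣ x ∣) u → X (signedStd u) ≡ X u
X∘signedStd u u>0 = cong [_]ᵇ (altUp-signedStd u u>0)

⊗-X : ∀ ρ → Unique (map ∣_∣ ρ) → All (λ x → 0 < ∣ x ∣) ρ → (X ⊗ X) ρ ≡ ∑-splits X X ρ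
⊗-X ρ uniq ρ>0 = trans (⊗≡∑-splits X X ρ uniq) (∑-cong (upTo (suc (length ρ))) (λ k →
  cong₂ _*_ (X∘signedStd (take k ρ) (All.take⁺ k ρ>0)) (X∘signedStd (drop k ρ) (All.drop⁺ k ρ>0))))

signedPerm-↭ : ∀ n ρ → IsSignedPerm n ρ → map ∣_∣ ρ ↭ upFrom 1 (length ρ)
signedPerm-↭ n ρ ρ↭ = subst (λ m → map ∣_∣ ρ ↭ upFrom 1 m) n≡length ρ↭upFrom
  where
  ρ↭upFrom : map ∣_∣ ρ ↭ upFrom 1 n
  ρ↭upFrom = ↭-trans ρ↭ (↭-reflexive (map-suc-upTo n))
  n≡length : n ≡ length ρ
  n≡length = trans (sym (length-upFrom 1 n)) (trans (sym (↭-length ρ↭upFrom)) (length-map ∣_∣ ρ))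

signedPerm-letters : ∀ ρ → map ∣_∣ ρ ↭ upFrom 1 (length ρ) → All (λ x → 0 < ∣ x ∣ × ∣ x ∣ ≤ length ρ) ρ
signedPerm-letters ρ ρ↭ = All.tabulate (λ x∈ → map₂ ≤-pred (∈-upFrom⁻ 1 (length ρ) (∈-resp-↭ ρ↭ (∈-map⁺ ∣_∣ x∈))))

theorem5p1 : (n : ℕ) (ρ : List ℤ) → IsSignedPerm n ρ → d X ρ ≡ (one ⊕ (X ⊗ X)) ρ
theorem5p1 n ρ ρ↭ = begin
  d X ρ                   ≡⟨ d≡∑-preimages X ρ ρ↭′ ⟩
  ∑-preimages L X ρ       ≡⟨ ∑-preimages-X L ρ (All.map proj₂ letters) ⟩
  one ρ + ∑-splits X X ρ  ≡⟨ cong (one ρ +_) (sym (⊗-X ρ uniq (All.map proj₁ letters))) ⟩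
  one ρ + (X ⊗ X) ρ       ∎
  where
  open ≡-Reasoning
  L : ℕ
  L = length ρ
  ρ↭′ : map ∣_∣ ρ ↭ upFrom 1 L
  ρ↭′ = signedPerm-↭ n ρ ρ↭
  letters : All (λ x → 0 < ∣ x ∣ × ∣ x ∣ ≤ L) ρ
  letters = signedPerm-letters ρ ρ↭′
  uniq : Unique (map ∣_∣ ρ)
  uniq = Permutationₛ.Unique-resp-↭ (setoid ℕ) (↭⇒↭ₛ (↭-sym ρ↭′)) (upFrom-unique 1 L)
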